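{- Let $x,y$ be real numbers with $x+y\neq 0$ and $x/(x+y)\geq 0$, let $z\in(-\infty,1]$, and let $n,p$ be positive integers. Then \[ \sum_{k=0}^n x^ky^{n-k}\binom{n}{k}\, \zeta_k^\star(\{1\}_p;z) =(-1)^{p-1} (x+y)^n \sum_{j=1}^n \left(\Big(\frac{xz+y}{x+y}\Big)^j-\Big(\frac{y}{x+y}\Big)^j\right)\left\{\sum_{i=0}^{p-1} (-1)^i \frac{Y_i(n)}{i!}\, \frac{s(j,p-i)}{j!}\right\}. \]
   Context: For a composition $\mathbf{k}=(k_1,\ldots,k_r)$ of positive integers, an integer $n\geq 0$ and a real $z$, define $\zeta^\star_n(\mathbf{k};z):=\sum_{n\geq n_1\geq\cdots\geq n_r\geq 1} \frac{z^{n_r}}{n_1^{k_1}\cdots n_r^{k_r}}$ (an empty sum, equal to $0$, when $n=0$). $\{1\}_p$ denotes the sequence $(1,\ldots,1)$ with $p$ entries. The convention $0^0=1$ is used. $s(n,k)$ denotes the unsigned Stirling numbers of the first kind, defined by $s(0,0)=1$, $s(n,0)=s(0,k)=0$ for $n,k\geq1$, and $s(n,k)=s(n-1,k-1)+(n-1)s(n-1,k)$ for $n,k\geq 1$ (so $s(n,k)=0$ if $n<k$). For integers $n\geq 0$, $k\geq 1$ let $H_n^{(k)}=\sum_{j=1}^n j^{ -k}$ and $H_n=H_n^{(1)}$. The complete exponential Bell polynomials $Y_k(x_1,\ldots,x_k)$ are defined by $\exp\big(\sum_{i\geq1} x_i t^i/i!\big)=\sum_{k\geq0} Y_k(x_1,\ldots,x_k)\,t^k/k!$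 (so $Y_0=1$, $Y_1=x_1$, $Y_2=x_1^2+x_2$, ...), and the Bell numbers are $Y_k(n):=Y_k\big(H_n,1!H_n^{(2)},2!H_n^{(3)},\ldots,(k-1)!H_n^{(k)}\big)$, with $Y_0(n)=1$. -}

module Defs where

open import Level using (Level; _⊔_)
open import Data.Nat as ℕ using (ℕ; zero; suc; _∸_)
open import Data.Nat.Combinatorics using (_C_)
open import Data.Nat.Base using (_!)
open import Data.List using (List; []; _∷_)
open import Algebra.Bundles using (CommutativeRing)
open import Relation.Binary.Structures using (IsTotalOrder)
open import Relation.Nullary using (¬_)

-- An ordered field (the real numbers are an instance).  We state the
-- theorem for every ordered field, which contains the real case.
record OrderedField (c ℓ₁ ℓ₂ : Level) : Set (Level.suc (c ⊔ ℓ₁ ⊔ ℓ₂)) where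
  field
    commutativeRing : CommutativeRing c ℓ₁
  open CommutativeRing commutativeRing public
  field
    _≤_          : Carrier → Carrier → Set ℓ₂
    isTotalOrder : IsTotalOrder _≈_ _≤_
    +-mono-≤     : ∀ {a b} (d : Carrier) → a ≤ b → (a + d) ≤ (b + d)
    *-nonneg     : ∀ {a b} → 0# ≤ a → 0# ≤ b → 0# ≤ (a * b)
    0≉1          : ¬ (0# ≈ 1#)
    inv          : Carrier → Carrier
    inv-inverse  : ∀ a → ¬ (a ≈ 0#) → (a * inv a) ≈ 1#

stirling1 : ℕ → ℕ → ℕ
stirling1 zero    zero    = 1
stirling1 zero    (suc k) = 0
stirling1 (suc n) zero    = 0
stirling1 (suc n) (suc k) = stirling1 n k ℕ.+ n ℕ.* stirling1 n (suc k)

module OFDefs {c ℓ₁ ℓ₂} (F : OrderedField c ℓ₁ ℓ₂) where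
  open OrderedField F

  _/_ : Carrier → Carrier → Carrier
  a / b = a * inv b

  pow : Carrier → ℕ → Carrier
  pow a zero    = 1#
  pow a (suc k) = a * pow a k

  fromℕ : ℕ → Carrier
  fromℕ zero    = 0#
  fromℕ (suc n) = 1# + fromℕ n

  sumR : ℕ → (ℕ → Carrier) → Carrier
  sumR zero    f = 0#
  sumR (suc n) f = sumR n f + f n

  -- zetaStar n (k ∷ ks) z = ζ⋆_n(k,ks;z)
  --   = Σ_{n ≥ n₁ ≥ ... ≥ n_r ≥ 1} z^{n_r} / (n₁^{k₁} ⋯ n_r^{k_r})
  -- (the empty composition is not used; we set it to 0).
  zetaNE : ℕ → ℕ → List ℕ → Carrier → Carrier
  zetaNE n k []         z = sumR n (λ m → pow (inv (fromℕ (suc m))) k * pow z (suc m))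
  zetaNE n k (k' ∷ ks)  z = sumR n (λ m → pow (inv (fromℕ (suc m))) k * zetaNE (suc m) k' ks z)

  zetaStar : ℕ → List ℕ → Carrier → Carrier
  zetaStar n []       z = 0#
  zetaStar n (k ∷ ks) z = zetaNE n k ks z

  ones : ℕ → List ℕ
  ones zero    = []
  ones (suc p) = 1 ∷ ones p

  harm : ℕ → ℕ → Carrier
  harm n k = sumR n (λ j → pow (inv (fromℕ (suc j))) k)

  -- complete exponential Bell polynomials, via the standard recurrence
  --   Y_{k+1} = Σ_{j=0}^{k} C(k,j) x_{j+1} Y_{k-j}
  -- (equivalent to the generating-function definition).  Here xs i = x_{i+1}.
  -- bellList xs k = [Y_k, Y_{k-1}, ..., Y_0]
  lookupD : List Carrier → ℕ → Carrier
  lookupD []       _       = 0#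
  lookupD (a ∷ as) zero    = a
  lookupD (a ∷ as) (suc j) = lookupD as j

  bellList : (ℕ → Carrier) → ℕ → List Carrier
  bellList xs zero    = 1# ∷ []
  bellList xs (suc k) =
    sumR (suc k) (λ j → fromℕ (k C j) * xs j * lookupD (bellList xs k) j)
    ∷ bellList xs k

  bellY : (ℕ → Carrier) → ℕ → Carrier
  bellY xs k = lookupD (bellList xs k) 0

  bellNum : ℕ → ℕ → Carrier
  bellNum k n = bellY (λ i → fromℕ (i !) * harm n (suc i)) k

module Submission where

-- Put a = x/(x+y) and b = y/(x+y), so that a + b = 1 and the left side is (x+y)ⁿ
-- times the binomial transform Σₖ C(n,k) aᵏ bⁿ⁻ᵏ ζ⋆ₖ({1}ₚ; z).  For the alternating
-- binomial sums Aₚ(k, t) = Σₘ (-1)^{m-1} C(k,m) tᵐ/mᵖ one has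
-- ζ⋆ₖ({1}ₚ; z) = Aₚ(k, 1) - Aₚ(k, 1 - z), as both sides satisfy
-- Fₚ(k+1) = Fₚ(k) + Fₚ₋₁(k+1)/(k+1).  Since Σₖ C(n,k) C(k,m) aᵏ bⁿ⁻ᵏ = C(n,m) aᵐ when
-- a + b = 1, the transform sends Aₚ(·, t) to Aₚ(n, a t); and 1 - a = y/(x+y),
-- 1 - a(1 - z) = (xz+y)/(x+y).  Finally Aₚ(n, t) = (-1)^{p-1} Σⱼ (1 - (1 - t)ʲ) cⱼ with
-- cⱼ the braced factor: both sides obey the recursion in n above, which on the right
-- comes from the recursions of hᵢ(1, 1/2, …, 1/n) in n and of s(j, q)/j! in j; and
-- Yᵢ(n)/i! = hᵢ(1, 1/2, …, 1/n) by Newton's identities.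

open import Defs
open import Data.Nat using (ℕ; suc; _∸_)
open import Data.Nat.Combinatorics using (_C_)
open import Data.Nat.Base using (_!)
open import Relation.Nullary using (¬_)

open import Algebra.Bundles using (CommutativeRing; RawRing)
open import Data.Maybe using (just; nothing)
open import Data.Nat as ℕ using (zero)
open import Data.Nat.Combinatorics
  using (nC1≡n; k>n⇒nCk≡0; nCk+nC[k+1]≡[n+1]C[k+1]; nCk≡n!/k![n-k]!; k![n∸k]!∣n!)
open import Data.Nat.DivMod using (m/n*n≡m)
import Data.Nat.Properties as ℕₚ
open import Data.Product using (_×_; _,_)
open import Data.Product.Properties using (≡-dec)
open import Data.Sum using (inj₁; inj₂)
open import Level using (0ℓ)
open import Relation.Binary.Definitions using (WeaklyDecidable)
open import Relation.Binary.PropositionalEquality as ≡ using (_≡_)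
open import Relation.Binary.Structures using (IsTotalOrder)
open import Relation.Nullary using (yes; no)

module CommutativeRingSolver {c ℓ} (R : CommutativeRing c ℓ) where
  open CommutativeRing R hiding (zero)
  open import Algebra.Solver.Ring.AlmostCommutativeRing
  open import Algebra.Properties.Monoid.Mult +-monoid using (×-homo-+) renaming (_×_ to _·_)
  open import Algebra.Properties.Semiring.Mult semiring using (×1-homo-*)
  open import Algebra.Properties.AbelianGroup +-abelianGroup using (ε⁻¹≈ε; ⁻¹-∙-comm; ⁻¹-anti-homo‿-)
  open import Algebra.Properties.CommutativeSemigroup +-commutativeSemigroup using (interchange)
  open import Algebra.Properties.Ring ring using (x[y-z]≈xy-xz; [y-z]x≈yx-zx)
  open import Relation.Binary.Reasoning.Setoid setoid

  -- Coefficients are formal differences a - b of naturals, kept in the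
  -- canonical form where a or b is 0 so that equal normal forms are
  -- syntactically equal.
  private
    canonical : ℕ × ℕ → ℕ × ℕ
    canonical (suc a , suc b)  = canonical (a , b)
    canonical (zero  , b)      = (zero , b)
    canonical (suc a , zero)   = (suc a , zero)

    differences : RawRing 0ℓ 0ℓ
    differences = record
      { Carrier = ℕ × ℕ
      ; _≈_     = _≡_
      ; _+_     = λ (a , b) (c , d) → canonical (a ℕ.+ c , b ℕ.+ d)
      ; _*_     = λ (a , b) (c , d) → canonical (a ℕ.* c ℕ.+ b ℕ.* d , a ℕ.* d ℕ.+ b ℕ.* c)
      ; -_      = λ (a , b) → (b , a)
      ; 0#      = (0 , 0)
      ; 1#      = (1 , 0)
      }

    diff : ℕ × ℕ → Carrier
    diff (a , b) = a · 1# - b · 1#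

    diff-+ : ∀ a b c d → diff (a ℕ.+ c , b ℕ.+ d) ≈ diff (a , b) + diff (c , d)
    diff-+ a b c d = begin
      (a ℕ.+ c) · 1# - (b ℕ.+ d) · 1#  ≈⟨ +-cong (×-homo-+ 1# a c) (-‿cong (×-homo-+ 1# b d)) ⟩
      (a′ + c′) - (b′ + d′)            ≈⟨ +-congˡ (⁻¹-∙-comm b′ d′) ⟨
      (a′ + c′) + (- b′ + - d′)        ≈⟨ interchange a′ c′ (- b′) (- d′) ⟩
      (a′ - b′) + (c′ - d′)            ∎
      where
      a′ b′ c′ d′ : Carrier
      a′ = a · 1#; b′ = b · 1#; c′ = c · 1#; d′ = d · 1#

    diff-* : ∀ a b c d → diff (a ℕ.* c ℕ.+ b ℕ.* d , a ℕ.* d ℕ.+ b ℕ.* c) ≈ diff (a , b) * diff (c , d)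
    diff-* a b c d = begin
      diff (a ℕ.* c ℕ.+ b ℕ.* d , a ℕ.* d ℕ.+ b ℕ.* c)
        ≈⟨ +-cong (trans (×-homo-+ 1# (a ℕ.* c) _) (+-cong (×1-homo-* a c) (×1-homo-* b d)))
                  (-‿cong (trans (×-homo-+ 1# (a ℕ.* d) _) (+-cong (×1-homo-* a d) (×1-homo-* b c)))) ⟩
      (a′ * c′ + b′ * d′) - (a′ * d′ + b′ * c′)
        ≈⟨ +-congˡ (⁻¹-∙-comm (a′ * d′) (b′ * c′)) ⟨
      (a′ * c′ + b′ * d′) + (- (a′ * d′) + - (b′ * c′))
        ≈⟨ interchange (a′ * c′) (b′ * d′) _ _ ⟩
      (a′ * c′ - a′ * d′) + (b′ * d′ - b′ * c′)
        ≈⟨ +-congˡ (⁻¹-anti-homo‿- (b′ * c′) (b′ * d′)) ⟨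
      (a′ * c′ - a′ * d′) - (b′ * c′ - b′ * d′)
        ≈⟨ +-cong (x[y-z]≈xy-xz a′ c′ d′) (-‿cong (x[y-z]≈xy-xz b′ c′ d′)) ⟨
      a′ * (c′ - d′) - b′ * (c′ - d′)
        ≈⟨ [y-z]x≈yx-zx (c′ - d′) a′ b′ ⟨
      (a′ - b′) * (c′ - d′)
        ∎
      where
      a′ b′ c′ d′ : Carrier
      a′ = a · 1#; b′ = b · 1#; c′ = c · 1#; d′ = d · 1#

    diff-canonical : ∀ x → diff (canonical x) ≈ diff x
    diff-canonical (suc a , suc b) = begin
      diff (canonical (a , b))     ≈⟨ diff-canonical (a , b) ⟩
      diff (a , b)                 ≈⟨ +-identityˡ _ ⟨
      0# + diff (a , b)            ≈⟨ +-congʳ (-‿inverseʳ (1 · 1#)) ⟨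
      diff (1 , 1) + diff (a , b)  ≈⟨ diff-+ 1 1 a b ⟨
      diff (suc a , suc b)         ∎
    diff-canonical (zero  , b)     = refl
    diff-canonical (suc a , zero)  = refl

    ⟨_⟩ : ℕ → Carrier
    ⟨ zero ⟩         = 0#
    ⟨ suc zero ⟩     = 1#
    ⟨ suc (suc n) ⟩  = 1# + ⟨ suc n ⟩

    ⟨⟩≈· : ∀ n → ⟨ n ⟩ ≈ n · 1#
    ⟨⟩≈· zero           = refl
    ⟨⟩≈· (suc zero)     = sym (+-identityʳ 1#)
    ⟨⟩≈· (suc (suc n))  = +-congˡ (⟨⟩≈· (suc n))

    -- Unlike diff, this sends (0 , 0) and (1 , 0) to 0# and 1# on the
    -- nose, as the constants of a solver equation must.
    fromDiff : ℕ × ℕ → Carrier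
    fromDiff (a , zero)   = ⟨ a ⟩
    fromDiff (a , suc b)  = ⟨ a ⟩ - ⟨ suc b ⟩

    fromDiff≈diff : ∀ x → fromDiff x ≈ diff x
    fromDiff≈diff (a , zero)   = trans (⟨⟩≈· a) (sym (trans (+-congˡ ε⁻¹≈ε) (+-identityʳ _)))
    fromDiff≈diff (a , suc b)  = +-cong (⟨⟩≈· a) (-‿cong (⟨⟩≈· (suc b)))

    fromDiff-canonical : ∀ x → fromDiff (canonical x) ≈ diff x
    fromDiff-canonical x = trans (fromDiff≈diff (canonical x)) (diff-canonical x)

    morphism : differences -Raw-AlmostCommutative⟶ fromCommutativeRing R
    morphism = record
      { ⟦_⟧    = fromDiff
      ; +-homo = λ (a , b) (c , d) → trans (fromDiff-canonical (a ℕ.+ c , b ℕ.+ d))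
                   (trans (diff-+ a b c d) (sym (+-cong (fromDiff≈diff (a , b)) (fromDiff≈diff (c , d)))))
      ; *-homo = λ (a , b) (c , d) → trans (fromDiff-canonical (a ℕ.* c ℕ.+ b ℕ.* d , a ℕ.* d ℕ.+ b ℕ.* c))
                   (trans (diff-* a b c d) (sym (*-cong (fromDiff≈diff (a , b)) (fromDiff≈diff (c , d)))))
      ; -‿homo = λ (a , b) → trans (fromDiff≈diff (b , a))
                   (trans (sym (⁻¹-anti-homo‿- (a · 1#) (b · 1#))) (-‿cong (sym (fromDiff≈diff (a , b)))))
      ; 0-homo = refl
      ; 1-homo = refl
      }

    fromDiff-≟ : WeaklyDecidable (Induced-equivalence morphism)
    fromDiff-≟ x y with ≡-dec ℕ._≟_ ℕ._≟_ x y
    ... | yes x≡y = just (reflexive (≡.cong fromDiff x≡y))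
    ... | no _    = nothing

  open import Algebra.Solver.Ring differences (fromCommutativeRing R) morphism fromDiff-≟ public

[1+m]*[1+k]C[1+m]≡[1+k]*kCm : ∀ k m → suc m ℕ.* (suc k C suc m) ≡ suc k ℕ.* (k C m)
[1+m]*[1+k]C[1+m]≡[1+k]*kCm k zero =
  ≡.trans (ℕₚ.+-identityʳ _) (≡.trans (nC1≡n (suc k)) (≡.sym (ℕₚ.*-identityʳ (suc k))))
[1+m]*[1+k]C[1+m]≡[1+k]*kCm zero (suc m) =
  ≡.trans (≡.cong (suc (suc m) ℕ.*_) (k>n⇒nCk≡0 {1} {suc (suc m)} (ℕ.s≤s (ℕ.s≤s ℕ.z≤n))))
          (≡.trans (ℕₚ.*-zeroʳ (suc (suc m))) (≡.cong (1 ℕ.*_) (≡.sym (k>n⇒nCk≡0 {0} {suc m} (ℕ.s≤s ℕ.z≤n)))))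
[1+m]*[1+k]C[1+m]≡[1+k]*kCm (suc k) (suc m) = begin
  suc (suc m) ℕ.* (suc (suc k) C suc (suc m))     ≡⟨ ≡.cong (suc (suc m) ℕ.*_) (pascal (suc k) (suc m)) ⟨
  suc (suc m) ℕ.* (P ℕ.+ Q)                        ≡⟨ ℕₚ.*-distribˡ-+ (suc (suc m)) P Q ⟩
  P ℕ.+ suc m ℕ.* P ℕ.+ suc (suc m) ℕ.* Q          ≡⟨ ≡.cong₂ (λ u v → P ℕ.+ u ℕ.+ v)
                                                        ([1+m]*[1+k]C[1+m]≡[1+k]*kCm k m)
                                                        ([1+m]*[1+k]C[1+m]≡[1+k]*kCm k (suc m)) ⟩
  P ℕ.+ suc k ℕ.* (k C m) ℕ.+ suc k ℕ.* (k C suc m) ≡⟨ ℕₚ.+-assoc P (suc k ℕ.* (k C m)) _ ⟩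
  P ℕ.+ (suc k ℕ.* (k C m) ℕ.+ suc k ℕ.* (k C suc m)) ≡⟨ ≡.cong (P ℕ.+_) (ℕₚ.*-distribˡ-+ (suc k) _ (k C suc m)) ⟨
  P ℕ.+ suc k ℕ.* (k C m ℕ.+ k C suc m)             ≡⟨ ≡.cong (λ u → P ℕ.+ suc k ℕ.* u) (pascal k m) ⟩
  suc (suc k) ℕ.* P                                ∎
  where
  open ≡.≡-Reasoning
  pascal : ∀ n k → n C k ℕ.+ n C suc k ≡ suc n C suc k
  pascal = nCk+nC[k+1]≡[n+1]C[k+1]
  P Q : ℕ
  P = suc k C suc m
  Q = suc k C suc (suc m)

nCk*[k!*[n∸k]!]≡n! : ∀ {n k} → k ℕ.≤ n → (n C k) ℕ.* (k ! ℕ.* (n ∸ k) !) ≡ n !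
nCk*[k!*[n∸k]!]≡n! {n} {k} k≤n =
  ≡.trans (≡.cong (ℕ._* (k ! ℕ.* (n ∸ k) !)) (nCk≡n!/k![n-k]! k≤n)) (m/n*n≡m (k![n∸k]!∣n! k≤n))
  where instance _ = ℕₚ._!*_!≢0 k (n ∸ k)

module _ {c ℓ₁ ℓ₂} (F : OrderedField c ℓ₁ ℓ₂) where
  open OrderedField F hiding (zero)
  open OFDefs F
  open CommutativeRingSolver commutativeRing
  open import Algebra.Properties.Ring ring using (-1*x≈-x)
  open import Algebra.Properties.AbelianGroup +-abelianGroup using (ε⁻¹≈ε; ⁻¹-∙-comm)
  open import Algebra.Properties.Monoid.Mult +-monoid using (×-homo-+) renaming (_×_ to _·_)
  open import Algebra.Properties.Semiring.Mult semiring using (×1-homo-*)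
  open import Relation.Binary.Reasoning.Setoid setoid
  private module ≤ = IsTotalOrder isTotalOrder

  𝟘 𝟙 : ∀ {n} → Polynomial n
  𝟘 = con (0 , 0)
  𝟙 = con (1 , 0)

  0≤1 : 0# ≤ 1#
  0≤1 with ≤.total 0# 1#
  ... | inj₁ 0≤1 = 0≤1
  ... | inj₂ 1≤0 = ≤.trans (*-nonneg 0≤-1 0≤-1) (≤.reflexive (solve 0 (:- 𝟙 :* :- 𝟙 := 𝟙) refl))
    where
    0≤-1 : 0# ≤ (- 1#)
    0≤-1 = ≤.trans (≤.reflexive (sym (-‿inverseʳ 1#))) (≤.trans (+-mono-≤ (- 1#) 1≤0) (≤.reflexive (+-identityˡ _)))

  1≤fromℕ-suc : ∀ m → 1# ≤ fromℕ (suc m)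
  0≤fromℕ : ∀ m → 0# ≤ fromℕ m

  1≤fromℕ-suc m = ≤.trans (≤.reflexive (sym (+-identityˡ 1#)))
                    (≤.trans (+-mono-≤ 1# (0≤fromℕ m)) (≤.reflexive (+-comm _ 1#)))
  0≤fromℕ zero    = ≤.refl
  0≤fromℕ (suc m) = ≤.trans 0≤1 (1≤fromℕ-suc m)

  fromℕ≉0 : ∀ n → {{ℕ.NonZero n}} → ¬ (fromℕ n ≈ 0#)
  fromℕ≉0 (suc m) fromℕ≈0 = 0≉1 (≤.antisym 0≤1 (≤.trans (1≤fromℕ-suc m) (≤.reflexive fromℕ≈0)))

  fromℕ≈·1 : ∀ n → fromℕ n ≈ n · 1#
  fromℕ≈·1 zero    = refl
  fromℕ≈·1 (suc n) = +-congˡ (fromℕ≈·1 n)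

  fromℕ-+ : ∀ m n → fromℕ (m ℕ.+ n) ≈ fromℕ m + fromℕ n
  fromℕ-+ m n = trans (fromℕ≈·1 (m ℕ.+ n))
    (trans (×-homo-+ 1# m n) (sym (+-cong (fromℕ≈·1 m) (fromℕ≈·1 n))))

  fromℕ-* : ∀ m n → fromℕ (m ℕ.* n) ≈ fromℕ m * fromℕ n
  fromℕ-* m n = trans (fromℕ≈·1 (m ℕ.* n))
    (trans (×1-homo-* m n) (sym (*-cong (fromℕ≈·1 m) (fromℕ≈·1 n))))

  fromℕ-cong : ∀ {m n} → m ≡ n → fromℕ m ≈ fromℕ n
  fromℕ-cong m≡n = reflexive (≡.cong fromℕ m≡n)

  inv-cancelˡ : ∀ {a} x → ¬ (a ≈ 0#) → inv a * (a * x) ≈ x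
  inv-cancelˡ {a} x a≉0 = begin
    inv a * (a * x)   ≈⟨ solve 3 (λ a a⁻¹ x → a⁻¹ :* (a :* x) := (a :* a⁻¹) :* x) refl a (inv a) x ⟩
    (a * inv a) * x   ≈⟨ *-congʳ (inv-inverse a a≉0) ⟩
    1# * x            ≈⟨ *-identityˡ x ⟩
    x                 ∎

  inv-unique : ∀ {a b} → ¬ (a ≈ 0#) → a * b ≈ 1# → b ≈ inv a
  inv-unique {a} {b} a≉0 ab≈1 = begin
    b                 ≈⟨ inv-cancelˡ b a≉0 ⟨
    inv a * (a * b)   ≈⟨ *-congˡ ab≈1 ⟩
    inv a * 1#        ≈⟨ *-identityʳ (inv a) ⟩
    inv a             ∎

  *-cancelˡ : ∀ {a x y} → ¬ (a ≈ 0#) → a * x ≈ a * y → x ≈ y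
  *-cancelˡ {x = x} {y} a≉0 ax≈ay =
    trans (sym (inv-cancelˡ x a≉0)) (trans (*-congˡ ax≈ay) (inv-cancelˡ y a≉0))

  invSuc : ℕ → Carrier
  invSuc m = inv (fromℕ (suc m))

  fromℕ-suc*invSuc : ∀ m → fromℕ (suc m) * invSuc m ≈ 1#
  fromℕ-suc*invSuc m = inv-inverse _ (fromℕ≉0 (suc m))

  -- Finite sums and powers

  sumR-cong-< : ∀ n {f g : ℕ → Carrier} → (∀ i → i ℕ.< n → f i ≈ g i) → sumR n f ≈ sumR n g
  sumR-cong-< zero    f≈g = refl
  sumR-cong-< (suc n) f≈g = +-cong (sumR-cong-< n (λ i i<n → f≈g i (ℕₚ.m<n⇒m<1+n i<n))) (f≈g n ℕₚ.≤-refl)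

  sumR-cong : ∀ n {f g : ℕ → Carrier} → (∀ i → f i ≈ g i) → sumR n f ≈ sumR n g
  sumR-cong n f≈g = sumR-cong-< n (λ i _ → f≈g i)

  sumR-≈0 : ∀ n {f : ℕ → Carrier} → (∀ i → i ℕ.< n → f i ≈ 0#) → sumR n f ≈ 0#
  sumR-≈0 zero    f≈0 = refl
  sumR-≈0 (suc n) f≈0 =
    trans (+-cong (sumR-≈0 n (λ i i<n → f≈0 i (ℕₚ.m<n⇒m<1+n i<n))) (f≈0 n ℕₚ.≤-refl)) (+-identityˡ 0#)

  sumR-+ : ∀ n (f g : ℕ → Carrier) → sumR n (λ i → f i + g i) ≈ sumR n f + sumR n g
  sumR-+ zero    f g = sym (+-identityˡ 0#)
  sumR-+ (suc n) f g = trans (+-congʳ (sumR-+ n f g))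
    (solve 4 (λ a b c d → (a :+ b) :+ (c :+ d) := (a :+ c) :+ (b :+ d)) refl _ _ _ _)

  sumR-neg : ∀ n (f : ℕ → Carrier) → - sumR n f ≈ sumR n (λ i → - f i)
  sumR-neg zero    f = ε⁻¹≈ε
  sumR-neg (suc n) f = trans (sym (⁻¹-∙-comm _ _)) (+-congʳ (sumR-neg n f))

  sumR-sub : ∀ n (f g : ℕ → Carrier) → sumR n (λ i → f i - g i) ≈ sumR n f - sumR n g
  sumR-sub n f g = trans (sumR-+ n f (λ i → - g i)) (+-congˡ (sym (sumR-neg n g)))

  *-distribˡ-sumR : ∀ n a (f : ℕ → Carrier) → a * sumR n f ≈ sumR n (λ i → a * f i)
  *-distribˡ-sumR zero    a f = zeroʳ a
  *-distribˡ-sumR (suc n) a f = trans (distribˡ a _ _) (+-congʳ (*-distribˡ-sumR n a f))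

  *-distribʳ-sumR : ∀ n a (f : ℕ → Carrier) → sumR n f * a ≈ sumR n (λ i → f i * a)
  *-distribʳ-sumR n a f = trans (*-comm _ a) (trans (*-distribˡ-sumR n a f) (sumR-cong n (λ i → *-comm a (f i))))

  sumR-head : ∀ n (f : ℕ → Carrier) → sumR (suc n) f ≈ f 0 + sumR n (λ i → f (suc i))
  sumR-head zero    f = +-comm _ _
  sumR-head (suc n) f = trans (+-congʳ (sumR-head n f)) (+-assoc _ _ _)

  sumR-swap : ∀ m n (f : ℕ → ℕ → Carrier) →
              sumR m (λ i → sumR n (λ j → f i j)) ≈ sumR n (λ j → sumR m (λ i → f i j))
  sumR-swap zero    n f = sym (sumR-≈0 n (λ _ _ → refl))
  sumR-swap (suc m) n f = trans (+-congʳ (sumR-swap m n f)) (sym (sumR-+ n _ _))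

  sumR-trailing-zeros : ∀ {k n} (f : ℕ → Carrier) → k ℕ.≤ n → (∀ i → k ℕ.≤ i → f i ≈ 0#) → sumR n f ≈ sumR k f
  sumR-trailing-zeros {k} f k≤n f≈0 with ℕₚ.m≤n⇒∃[o]m+o≡n k≤n
  ... | d , ≡.refl = go d
    where
    go : ∀ d → sumR (k ℕ.+ d) f ≈ sumR k f
    go zero    = reflexive (≡.cong (λ m → sumR m f) (ℕₚ.+-identityʳ k))
    go (suc d) = begin
      sumR (k ℕ.+ suc d) f            ≡⟨ ≡.cong (λ m → sumR m f) (ℕₚ.+-suc k d) ⟩
      sumR (k ℕ.+ d) f + f (k ℕ.+ d)  ≈⟨ +-cong (go d) (f≈0 _ (ℕₚ.m≤m+n k d)) ⟩
      sumR k f + 0#                   ≈⟨ +-identityʳ _ ⟩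
      sumR k f                        ∎

  sumR-unique : ∀ (s d : ℕ → Carrier) → s 0 ≈ 0# → (∀ k → s (suc k) ≈ s k + d k) → ∀ n → s n ≈ sumR n d
  sumR-unique s d s0≈0 step zero    = s0≈0
  sumR-unique s d s0≈0 step (suc n) = trans (step n) (+-congʳ (sumR-unique s d s0≈0 step n))

  pow-cong : ∀ {a b} n → a ≈ b → pow a n ≈ pow b n
  pow-cong zero    a≈b = refl
  pow-cong (suc n) a≈b = *-cong a≈b (pow-cong n a≈b)

  pow-+ : ∀ a m n → pow a (m ℕ.+ n) ≈ pow a m * pow a n
  pow-+ a zero    n = sym (*-identityˡ _)
  pow-+ a (suc m) n = trans (*-congˡ (pow-+ a m n)) (sym (*-assoc _ _ _))

  pow-* : ∀ a b n → pow (a * b) n ≈ pow a n * pow b n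
  pow-* a b zero    = sym (*-identityˡ 1#)
  pow-* a b (suc n) = trans (*-congˡ (pow-* a b n))
    (solve 4 (λ a b c d → (a :* b) :* (c :* d) := (a :* c) :* (b :* d)) refl _ _ _ _)

  pow-1 : ∀ n → pow 1# n ≈ 1#
  pow-1 zero    = refl
  pow-1 (suc n) = trans (*-identityˡ _) (pow-1 n)

  pow-neg : ∀ a n → pow (- a) n ≈ pow (- 1#) n * pow a n
  pow-neg a n = trans (pow-cong n (sym (-1*x≈-x a))) (pow-* (- 1#) a n)

  sign-square : ∀ n → pow (- 1#) n * pow (- 1#) n ≈ 1#
  sign-square n = trans (sym (pow-* (- 1#) (- 1#) n))
    (trans (pow-cong n (solve 0 (:- 𝟙 :* :- 𝟙 := 𝟙) refl)) (pow-1 n))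

  -- Binomial transforms

  fromℕ-pascal : ∀ n k → fromℕ (suc n C suc k) ≈ fromℕ (n C k) + fromℕ (n C suc k)
  fromℕ-pascal n k = trans (fromℕ-cong (≡.sym (nCk+nC[k+1]≡[n+1]C[k+1] n k))) (fromℕ-+ (n C k) _)

  fromℕ-C-vanish : ∀ {n k} → n ℕ.< k → fromℕ (n C k) ≈ 0#
  fromℕ-C-vanish n<k = fromℕ-cong (k>n⇒nCk≡0 n<k)

  sumR-pascal : ∀ n (h : ℕ → Carrier) →
                sumR (suc (suc n)) (λ k → fromℕ (suc n C k) * h k)
                ≈ sumR (suc n) (λ k → fromℕ (n C k) * h k) + sumR (suc n) (λ k → fromℕ (n C k) * h (suc k))
  sumR-pascal n h = begin
    sumR (suc (suc n)) (λ k → fromℕ (suc n C k) * h k)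
      ≈⟨ sumR-head (suc n) _ ⟩
    fromℕ (n C 0) * h 0 + sumR (suc n) (λ k → fromℕ (suc n C suc k) * h (suc k))
      ≈⟨ +-congˡ (sumR-cong (suc n) (λ k → trans (*-congʳ (fromℕ-pascal n k)) (trans (distribʳ _ _ _) (+-comm _ _)))) ⟩
    fromℕ (n C 0) * h 0 + sumR (suc n) (λ k → fromℕ (n C suc k) * h (suc k) + fromℕ (n C k) * h (suc k))
      ≈⟨ trans (+-congˡ (sumR-+ (suc n) _ _)) (sym (+-assoc _ _ _)) ⟩
    (fromℕ (n C 0) * h 0 + sumR (suc n) (λ k → fromℕ (n C suc k) * h (suc k))) + S
      ≈⟨ +-congʳ (sumR-head (suc n) _) ⟨
    sumR (suc (suc n)) (λ k → fromℕ (n C k) * h k) + S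
      ≈⟨ +-congʳ (sumR-trailing-zeros _ (ℕₚ.n≤1+n (suc n)) (λ i n<i → trans (*-congʳ (fromℕ-C-vanish n<i)) (zeroˡ _))) ⟩
    sumR (suc n) (λ k → fromℕ (n C k) * h k) + S
      ∎
    where
    S : Carrier
    S = sumR (suc n) (λ k → fromℕ (n C k) * h (suc k))

  binomialTransform : Carrier → Carrier → ℕ → (ℕ → Carrier) → Carrier
  binomialTransform a b n g = sumR (suc n) (λ k → fromℕ (n C k) * (pow a k * pow b (n ∸ k) * g k))

  binomialTransform-cong : ∀ a b n {g h : ℕ → Carrier} → (∀ k → g k ≈ h k) →
                           binomialTransform a b n g ≈ binomialTransform a b n h
  binomialTransform-cong a b n g≈h = sumR-cong (suc n) (λ k → *-congˡ (*-congˡ (g≈h k)))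

  binomialTransform-+ : ∀ a b n (g h : ℕ → Carrier) →
                        binomialTransform a b n (λ k → g k + h k) ≈ binomialTransform a b n g + binomialTransform a b n h
  binomialTransform-+ a b n g h = trans (sumR-cong (suc n) (λ k →
    solve 5 (λ c u v x y → c :* (u :* v :* (x :+ y)) := c :* (u :* v :* x) :+ c :* (u :* v :* y)) refl _ _ _ _ _))
    (sumR-+ (suc n) _ _)

  binomialTransform-sub : ∀ a b n (g h : ℕ → Carrier) →
                        binomialTransform a b n (λ k → g k - h k) ≈ binomialTransform a b n g - binomialTransform a b n h
  binomialTransform-sub a b n g h = trans (sumR-cong (suc n) (λ k →
    solve 5 (λ c u v x y → c :* (u :* v :* (x :- y)) := c :* (u :* v :* x) :- c :* (u :* v :* y)) refl _ _ _ _ _))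
    (sumR-sub (suc n) _ _)

  binomialTransform-suc : ∀ a b n (g : ℕ → Carrier) →
    binomialTransform a b (suc n) g ≈ b * binomialTransform a b n g + a * binomialTransform a b n (λ k → g (suc k))
  binomialTransform-suc a b n g = begin
    binomialTransform a b (suc n) g
      ≈⟨ sumR-pascal n _ ⟩
    sumR (suc n) (λ k → fromℕ (n C k) * (pow a k * pow b (suc n ∸ k) * g k))
      + sumR (suc n) (λ k → fromℕ (n C k) * (pow a (suc k) * pow b (n ∸ k) * g (suc k)))
      ≈⟨ +-cong (sumR-cong-< (suc n) λ k k<1+n → *-congˡ (*-congʳ (*-congˡ (pow-cong′ (ℕₚ.+-∸-assoc 1 (ℕₚ.≤-pred k<1+n))))))
                (sumR-cong (suc n) λ k → solve 5 (λ c a u v x → c :* (a :* u :* v :* x) := a :* (c :* (u :* v :* x))) refl _ a _ _ _) ⟩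
    sumR (suc n) (λ k → fromℕ (n C k) * (pow a k * (b * pow b (n ∸ k)) * g k))
      + sumR (suc n) (λ k → a * (fromℕ (n C k) * (pow a k * pow b (n ∸ k) * g (suc k))))
      ≈⟨ +-cong (sumR-cong (suc n) λ k → solve 5 (λ c u b v x → c :* (u :* (b :* v) :* x) := b :* (c :* (u :* v :* x))) refl _ _ b _ _)
                (sym (*-distribˡ-sumR (suc n) a _)) ⟩
    sumR (suc n) (λ k → b * (fromℕ (n C k) * (pow a k * pow b (n ∸ k) * g k)))
      + a * binomialTransform a b n (λ k → g (suc k))
      ≈⟨ +-congʳ (sym (*-distribˡ-sumR (suc n) b _)) ⟩
    b * binomialTransform a b n g + a * binomialTransform a b n (λ k → g (suc k))
      ∎
    where
    pow-cong′ : ∀ {i j} → i ≡ j → pow b i ≈ pow b j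
    pow-cong′ i≡j = reflexive (≡.cong (pow b) i≡j)

  binomial : ∀ a b n → pow (a + b) n ≈ binomialTransform a b n (λ _ → 1#)
  binomial a b zero    = solve 0 (𝟙 := 𝟘 :+ (𝟙 :+ 𝟘) :* (𝟙 :* 𝟙 :* 𝟙)) refl
  binomial a b (suc n) = begin
    (a + b) * pow (a + b) n     ≈⟨ *-congˡ (binomial a b n) ⟩
    (a + b) * B                 ≈⟨ solve 3 (λ a b t → (a :+ b) :* t := b :* t :+ a :* t) refl a b B ⟩
    b * B + a * B               ≈⟨ binomialTransform-suc a b n _ ⟨
    binomialTransform a b (suc n) (λ _ → 1#)  ∎
    where
    B : Carrier
    B = binomialTransform a b n (λ _ → 1#)

  binomialTransform-choose : ∀ {a b} → a + b ≈ 1# → ∀ n m →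
                             binomialTransform a b n (λ k → fromℕ (k C m)) ≈ fromℕ (n C m) * pow a m
  binomialTransform-choose a+b≈1 zero zero =
    solve 0 (𝟘 :+ (𝟙 :+ 𝟘) :* (𝟙 :* 𝟙 :* (𝟙 :+ 𝟘)) := (𝟙 :+ 𝟘) :* 𝟙) refl
  binomialTransform-choose {a} a+b≈1 zero (suc m) = begin
    0# + fromℕ 1 * (1# * 1# * fromℕ (0 C suc m))  ≈⟨ +-congˡ (*-congˡ (*-congˡ 0C[1+m]≈0)) ⟩
    0# + fromℕ 1 * (1# * 1# * 0#)                 ≈⟨ solve 0 (𝟘 :+ (𝟙 :+ 𝟘) :* (𝟙 :* 𝟙 :* 𝟘) := 𝟘) refl ⟩
    0#                                            ≈⟨ zeroˡ _ ⟨
    0# * pow a (suc m)                            ≈⟨ *-congʳ 0C[1+m]≈0 ⟨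
    fromℕ (0 C suc m) * pow a (suc m)             ∎
    where
    0C[1+m]≈0 : fromℕ (0 C suc m) ≈ 0#
    0C[1+m]≈0 = fromℕ-C-vanish {0} {suc m} (ℕ.s≤s ℕ.z≤n)
  binomialTransform-choose {a} {b} a+b≈1 (suc n) m =
    trans (binomialTransform-suc a b n _) (pascal-step m)
    where
    T : ℕ → Carrier
    T m = binomialTransform a b n (λ k → fromℕ (k C m))

    pascal-step : ∀ m → b * T m + a * binomialTransform a b n (λ k → fromℕ (suc k C m)) ≈ fromℕ (suc n C m) * pow a m
    pascal-step zero = begin
      b * T 0 + a * T 0  ≈⟨ solve 3 (λ a b t → b :* t :+ a :* t := (a :+ b) :* t) refl a b _ ⟩
      (a + b) * T 0      ≈⟨ trans (*-congʳ a+b≈1) (*-identityˡ _) ⟩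
      T 0                ≈⟨ binomialTransform-choose a+b≈1 n 0 ⟩
      fromℕ (n C 0) * 1# ∎
    pascal-step (suc m) = begin
      b * T (suc m) + a * binomialTransform a b n (λ k → fromℕ (suc k C suc m))
        ≈⟨ +-congˡ (*-congˡ (trans (binomialTransform-cong a b n (λ k → fromℕ-pascal k m)) (binomialTransform-+ a b n _ _))) ⟩
      b * T (suc m) + a * (T m + T (suc m))
        ≈⟨ +-cong (*-congˡ (IH (suc m))) (*-congˡ (+-cong (IH m) (IH (suc m)))) ⟩
      b * (y * (a * p)) + a * (x * p + y * (a * p))
        ≈⟨ solve 5 (λ a b x y p → b :* (y :* (a :* p)) :+ a :* (x :* p :+ y :* (a :* p))
                                  := (x :+ y) :* (a :* p) :+ (a :+ b :- 𝟙) :* (y :* (a :* p))) refl a b x y p ⟩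
      (x + y) * (a * p) + (a + b - 1#) * (y * (a * p))
        ≈⟨ +-congˡ (trans (*-congʳ (trans (+-congʳ a+b≈1) (-‿inverseʳ 1#))) (zeroˡ _)) ⟩
      (x + y) * (a * p) + 0#
        ≈⟨ trans (+-identityʳ _) (*-congʳ (sym (fromℕ-pascal n m))) ⟩
      fromℕ (suc n C suc m) * pow a (suc m)
        ∎
      where
      IH : ∀ m → T m ≈ fromℕ (n C m) * pow a m
      IH = binomialTransform-choose a+b≈1 n
      x y p : Carrier
      x = fromℕ (n C m)
      y = fromℕ (n C suc m)
      p = pow a m

  -- Alternating binomial sums and ζ⋆

  fromℕ-C-absorb : ∀ k m → fromℕ (k C m) * invSuc m ≈ invSuc k * fromℕ (suc k C suc m)
  fromℕ-C-absorb k m = begin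
    X * invSuc m                      ≈⟨ *-identityˡ _ ⟨
    1# * (X * invSuc m)               ≈⟨ *-congʳ (fromℕ-suc*invSuc k) ⟨
    (K * invSuc k) * (X * invSuc m)
      ≈⟨ solve 4 (λ K r′ X r → (K :* r′) :* (X :* r) := r′ :* (K :* X) :* r) refl K (invSuc k) X (invSuc m) ⟩
    invSuc k * (K * X) * invSuc m     ≈⟨ *-congʳ (*-congˡ KX≈MY) ⟩
    invSuc k * (M * Y) * invSuc m
      ≈⟨ solve 4 (λ r′ M Y r → r′ :* (M :* Y) :* r := r′ :* Y :* (M :* r)) refl (invSuc k) M Y (invSuc m) ⟩
    invSuc k * Y * (M * invSuc m)     ≈⟨ *-congˡ (fromℕ-suc*invSuc m) ⟩
    invSuc k * Y * 1#                 ≈⟨ *-identityʳ _ ⟩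
    invSuc k * Y                      ∎
    where
    X Y K M : Carrier
    X = fromℕ (k C m)
    Y = fromℕ (suc k C suc m)
    K = fromℕ (suc k)
    M = fromℕ (suc m)
    KX≈MY : K * X ≈ M * Y
    KX≈MY = trans (sym (fromℕ-* (suc k) (k C m)))
              (trans (fromℕ-cong (≡.sym ([1+m]*[1+k]C[1+m]≡[1+k]*kCm k m))) (fromℕ-* (suc m) (suc k C suc m)))

  -- altBinomial p k t = Σ_{m=1}^{k} (-1)^{m-1} C(k,m) tᵐ / mᵖ; altTerm is indexed by m - 1.
  altTerm : ℕ → Carrier → ℕ → Carrier
  altTerm p t m = pow (- 1#) m * pow t (suc m) * pow (invSuc m) p

  altBinomial : ℕ → ℕ → Carrier → Carrier
  altBinomial p k t = sumR k (λ m → fromℕ (k C suc m) * altTerm p t m)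

  altBinomial-zero : ∀ k t → altBinomial 0 k t ≈ 1# - pow (1# - t) k
  altBinomial-zero k t = begin
    A                                               ≈⟨ solve 1 (λ A → A := 𝟙 :- (𝟙 :+ :- A)) refl A ⟩
    1# - (1# + - A)                                 ≈⟨ +-congˡ (-‿cong expand) ⟨
    1# - binomialTransform (- t) 1# k (λ _ → 1#)    ≈⟨ +-congˡ (-‿cong (binomial (- t) 1# k)) ⟨
    1# - pow (- t + 1#) k                           ≈⟨ +-congˡ (-‿cong (pow-cong k (+-comm _ _))) ⟩
    1# - pow (1# - t) k                             ∎
    where
    A : Carrier
    A = altBinomial 0 k t
    constant-term : fromℕ (k C 0) * (pow (- t) 0 * pow 1# k * 1#) ≈ 1#
    constant-term = trans (*-congˡ (*-congʳ (*-congˡ (pow-1 k)))) (solve 0 ((𝟙 :+ 𝟘) :* (𝟙 :* 𝟙 :* 𝟙) := 𝟙) refl)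
    term≈-altTerm : ∀ m → fromℕ (k C suc m) * (pow (- t) (suc m) * pow 1# (k ∸ suc m) * 1#)
                 ≈ - (fromℕ (k C suc m) * altTerm 0 t m)
    term≈-altTerm m = trans (*-congˡ (*-congʳ (*-cong (pow-neg t (suc m)) (pow-1 (k ∸ suc m)))))
      (solve 3 (λ c s u → c :* ((:- 𝟙 :* s) :* u :* 𝟙 :* 𝟙) := :- (c :* (s :* u :* 𝟙))) refl _ _ _)
    expand : binomialTransform (- t) 1# k (λ _ → 1#) ≈ 1# + - A
    expand = trans (sumR-head k _) (+-cong constant-term (trans (sumR-cong k term≈-altTerm) (sym (sumR-neg k _))))

  altBinomial-suc : ∀ p k t → altBinomial (suc p) (suc k) t ≈ altBinomial (suc p) k t + invSuc k * altBinomial p (suc k) t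
  altBinomial-suc p k t = begin
    altBinomial (suc p) (suc k) t
      ≈⟨ sumR-cong (suc k) (λ m → trans (*-congʳ (fromℕ-pascal k m)) (distribʳ _ _ _)) ⟩
    sumR (suc k) (λ m → fromℕ (k C m) * altTerm (suc p) t m + fromℕ (k C suc m) * altTerm (suc p) t m)
      ≈⟨ sumR-+ (suc k) _ _ ⟩
    sumR (suc k) (λ m → fromℕ (k C m) * altTerm (suc p) t m)
      + (altBinomial (suc p) k t + fromℕ (k C suc k) * altTerm (suc p) t k)
      ≈⟨ +-cong (sumR-cong (suc k) absorb) (+-congˡ (trans (*-congʳ (fromℕ-C-vanish (ℕₚ.n<1+n k))) (zeroˡ _))) ⟩
    sumR (suc k) (λ m → invSuc k * (fromℕ (suc k C suc m) * altTerm p t m)) + (altBinomial (suc p) k t + 0#)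
      ≈⟨ +-cong (sym (*-distribˡ-sumR (suc k) (invSuc k) _)) (+-identityʳ _) ⟩
    invSuc k * altBinomial p (suc k) t + altBinomial (suc p) k t
      ≈⟨ +-comm _ _ ⟩
    altBinomial (suc p) k t + invSuc k * altBinomial p (suc k) t
      ∎
    where
    absorb : ∀ m → fromℕ (k C m) * altTerm (suc p) t m ≈ invSuc k * (fromℕ (suc k C suc m) * altTerm p t m)
    absorb m = begin
      fromℕ (k C m) * (s * u * (invSuc m * q))
        ≈⟨ solve 5 (λ x s u r q → x :* (s :* u :* (r :* q)) := (x :* r) :* (s :* u :* q)) refl _ s u (invSuc m) q ⟩
      (fromℕ (k C m) * invSuc m) * altTerm p t m
        ≈⟨ *-congʳ (fromℕ-C-absorb k m) ⟩
      invSuc k * fromℕ (suc k C suc m) * altTerm p t m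
        ≈⟨ *-assoc _ _ _ ⟩
      invSuc k * (fromℕ (suc k C suc m) * altTerm p t m)
        ∎
      where
      s u q : Carrier
      s = pow (- 1#) m
      u = pow t (suc m)
      q = pow (invSuc m) p

  altBinomialDiff : ℕ → Carrier → ℕ → Carrier
  altBinomialDiff p z k = altBinomial p k 1# - altBinomial p k (1# - z)

  altBinomialDiff-zero : ∀ z k → altBinomialDiff 0 z (suc k) ≈ pow z (suc k)
  altBinomialDiff-zero z k = begin
    altBinomial 0 (suc k) 1# - altBinomial 0 (suc k) (1# - z)
      ≈⟨ +-cong (altBinomial-zero (suc k) 1#) (-‿cong (altBinomial-zero (suc k) (1# - z))) ⟩
    (1# - pow (1# - 1#) (suc k)) - (1# - pow (1# - (1# - z)) (suc k))
      ≈⟨ +-cong (+-congˡ (-‿cong (trans (pow-cong (suc k) (-‿inverseʳ 1#)) (zeroˡ _))))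
                (-‿cong (+-congˡ (-‿cong (pow-cong (suc k) (solve 1 (λ z → 𝟙 :- (𝟙 :- z) := z) refl z))))) ⟩
    (1# - 0#) - (1# - pow z (suc k))
      ≈⟨ solve 1 (λ q → (𝟙 :- 𝟘) :- (𝟙 :- q) := q) refl _ ⟩
    pow z (suc k)
      ∎

  altBinomialDiff-suc : ∀ p z k → altBinomialDiff (suc p) z k ≈ sumR k (λ m → invSuc m * altBinomialDiff p z (suc m))
  altBinomialDiff-suc p z = sumR-unique (altBinomialDiff (suc p) z) _ (-‿inverseʳ 0#) λ k →
    trans (+-cong (altBinomial-suc p k 1#) (-‿cong (altBinomial-suc p k (1# - z))))
      (solve 5 (λ a b r c d → (a :+ r :* b) :- (c :+ r :* d) := (a :- c) :+ r :* (b :- d)) refl _ _ (invSuc k) _ _)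

  zetaStar-ones : ∀ p k z → zetaStar k (ones (suc p)) z ≈ altBinomialDiff (suc p) z k
  zetaStar-ones zero    k z = sym (trans (altBinomialDiff-suc 0 z k)
    (sumR-cong k λ m → trans (*-congˡ (altBinomialDiff-zero z m)) (*-congʳ (sym (*-identityʳ _)))))
  zetaStar-ones (suc p) k z = sym (trans (altBinomialDiff-suc (suc p) z k)
    (sumR-cong k λ m → *-cong (sym (*-identityʳ _)) (sym (zetaStar-ones p (suc m) z))))

  altBinomial-transform : ∀ {a b} → a + b ≈ 1# → ∀ p n t →
                          binomialTransform a b n (λ k → altBinomial p k t) ≈ altBinomial p n (a * t)
  altBinomial-transform {a} {b} a+b≈1 p n t = begin
    binomialTransform a b n (λ k → altBinomial p k t)
      ≈⟨ sumR-cong-< (suc n) (λ k k<1+n → *-congˡ (*-congˡ (pad k (ℕₚ.≤-pred k<1+n)))) ⟩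
    sumR (suc n) (λ k → fromℕ (n C k) * (w k * sumR n (λ m → fromℕ (k C suc m) * altTerm p t m)))
      ≈⟨ sumR-cong (suc n) distribute ⟩
    sumR (suc n) (λ k → sumR n (λ m → fromℕ (n C k) * (w k * fromℕ (k C suc m)) * altTerm p t m))
      ≈⟨ sumR-swap (suc n) n _ ⟩
    sumR n (λ m → sumR (suc n) (λ k → fromℕ (n C k) * (w k * fromℕ (k C suc m)) * altTerm p t m))
      ≈⟨ sumR-cong n (λ m → sym (*-distribʳ-sumR (suc n) (altTerm p t m) _)) ⟩
    sumR n (λ m → binomialTransform a b n (λ k → fromℕ (k C suc m)) * altTerm p t m)
      ≈⟨ sumR-cong n (λ m → trans (*-congʳ (binomialTransform-choose a+b≈1 n (suc m))) (rescale m)) ⟩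
    altBinomial p n (a * t)
      ∎
    where
    w : ℕ → Carrier
    w k = pow a k * pow b (n ∸ k)

    pad : ∀ k → k ℕ.≤ n → altBinomial p k t ≈ sumR n (λ m → fromℕ (k C suc m) * altTerm p t m)
    pad k k≤n = sym (sumR-trailing-zeros _ k≤n (λ i k≤i → trans (*-congʳ (fromℕ-C-vanish (ℕ.s≤s k≤i))) (zeroˡ _)))

    distribute : ∀ k → fromℕ (n C k) * (w k * sumR n (λ m → fromℕ (k C suc m) * altTerm p t m))
                       ≈ sumR n (λ m → fromℕ (n C k) * (w k * fromℕ (k C suc m)) * altTerm p t m)
    distribute k = trans (*-congˡ (*-distribˡ-sumR n (w k) _)) (trans (*-distribˡ-sumR n _ _)
      (sumR-cong n λ m → solve 4 (λ c u x α → c :* (u :* (x :* α)) := c :* (u :* x) :* α) refl _ _ _ _))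

    rescale : ∀ m → fromℕ (n C suc m) * pow a (suc m) * altTerm p t m ≈ fromℕ (n C suc m) * altTerm p (a * t) m
    rescale m = trans
      (solve 5 (λ c x s y q → c :* x :* (s :* y :* q) := c :* (s :* (x :* y) :* q)) refl _ _ _ _ _)
      (*-congˡ (*-congʳ (*-congˡ (sym (pow-* a t (suc m))))))

  -- Complete homogeneous polynomials and Bell numbers

  -- hᵢ(1, 1/2, …, 1/n), the complete homogeneous symmetric polynomial
  completeHom : ℕ → ℕ → Carrier
  completeHom zero    n       = 1#
  completeHom (suc i) zero    = 0#
  completeHom (suc i) (suc n) = completeHom (suc i) n + invSuc n * completeHom i (suc n)

  completeHom-cong : ∀ {i j} n → i ≡ j → completeHom i n ≈ completeHom j n
  completeHom-cong n i≡j = reflexive (≡.cong (λ i → completeHom i n) i≡j)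

  completeHom-unroll : ∀ k n → completeHom k (suc n) ≈ sumR (suc k) (λ a → pow (invSuc n) a * completeHom (k ∸ a) n)
  completeHom-unroll zero    n = solve 0 (𝟙 := 𝟘 :+ 𝟙 :* 𝟙) refl
  completeHom-unroll (suc k) n = begin
    completeHom (suc k) n + r * completeHom k (suc n)
      ≈⟨ +-cong (sym (*-identityˡ _)) (*-congˡ (completeHom-unroll k n)) ⟩
    1# * completeHom (suc k) n + r * sumR (suc k) (λ a → pow r a * completeHom (k ∸ a) n)
      ≈⟨ +-congˡ (trans (*-distribˡ-sumR (suc k) r _) (sumR-cong (suc k) (λ a → sym (*-assoc _ _ _)))) ⟩
    1# * completeHom (suc k) n + sumR (suc k) (λ a → pow r (suc a) * completeHom (suc k ∸ suc a) n)
      ≈⟨ sumR-head (suc k) _ ⟨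
    sumR (suc (suc k)) (λ a → pow r a * completeHom (suc k ∸ a) n)
      ∎
    where
    r : Carrier
    r = invSuc n

  -- harm n j is the power sum pⱼ(1, 1/2, …, 1/n).
  newtonSum : ℕ → ℕ → Carrier
  newtonSum k n = sumR (suc k) (λ j → harm n (suc j) * completeHom (k ∸ j) n)

  newton-identity : ∀ n k → fromℕ (suc k) * completeHom (suc k) n ≈ newtonSum k n
  newton-identity zero    k       = trans (zeroʳ _) (sym (sumR-≈0 (suc k) (λ j _ → zeroˡ _)))
  newton-identity (suc n) zero    = begin
    (1# + 0#) * (completeHom 1 n + invSuc n * 1#)
      ≈⟨ solve 2 (λ h r → (𝟙 :+ 𝟘) :* (h :+ r :* 𝟙) := (𝟙 :+ 𝟘) :* h :+ r) refl _ _ ⟩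
    (1# + 0#) * completeHom 1 n + invSuc n
      ≈⟨ +-congʳ (newton-identity n 0) ⟩
    (0# + harm n 1 * 1#) + invSuc n
      ≈⟨ solve 2 (λ p r → (𝟘 :+ p :* 𝟙) :+ r := 𝟘 :+ (p :+ r :* 𝟙) :* 𝟙) refl _ _ ⟩
    newtonSum 0 (suc n)
      ∎
  newton-identity (suc n) (suc k) = begin
    fromℕ (suc (suc k)) * (h (suc (suc k)) + r * H (suc k))
      ≈⟨ solve 4 (λ K a r b → (𝟙 :+ K) :* (a :+ r :* b) := (𝟙 :+ K) :* a :+ r :* b :+ r :* (K :* b)) refl
           (fromℕ (suc k)) (h (suc (suc k))) r (H (suc k)) ⟩
    fromℕ (suc (suc k)) * h (suc (suc k)) + r * H (suc k) + r * (fromℕ (suc k) * H (suc k))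
      ≈⟨ +-cong (+-cong (newton-identity n (suc k)) (*-congˡ (completeHom-unroll (suc k) n)))
                (*-congˡ (newton-identity (suc n) k)) ⟩
    newtonSum (suc k) n + r * sumR (suc (suc k)) (λ a → pow r a * h (suc k ∸ a)) + r * newtonSum k (suc n)
      ≈⟨ +-congʳ powerSums ⟩
    sumR (suc (suc k)) (λ j → P (suc j) * h (suc k ∸ j)) + r * newtonSum k (suc n)
      ≈⟨ merge ⟩
    newtonSum (suc k) (suc n)
      ∎
    where
    r : Carrier
    r = invSuc n
    h H P : ℕ → Carrier
    h i = completeHom i n
    H i = completeHom i (suc n)
    P j = harm (suc n) j

    powerSums : newtonSum (suc k) n + r * sumR (suc (suc k)) (λ a → pow r a * h (suc k ∸ a))
                ≈ sumR (suc (suc k)) (λ j → P (suc j) * h (suc k ∸ j))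
    powerSums = begin
      newtonSum (suc k) n + r * sumR (suc (suc k)) (λ a → pow r a * h (suc k ∸ a))
        ≈⟨ +-congˡ (trans (*-distribˡ-sumR (suc (suc k)) r _) (sumR-cong (suc (suc k)) (λ a → sym (*-assoc _ _ _)))) ⟩
      newtonSum (suc k) n + sumR (suc (suc k)) (λ j → pow r (suc j) * h (suc k ∸ j))
        ≈⟨ sumR-+ (suc (suc k)) _ _ ⟨
      sumR (suc (suc k)) (λ j → harm n (suc j) * h (suc k ∸ j) + pow r (suc j) * h (suc k ∸ j))
        ≈⟨ sumR-cong (suc (suc k)) (λ j → sym (distribʳ _ _ _)) ⟩
      sumR (suc (suc k)) (λ j → P (suc j) * h (suc k ∸ j))
        ∎

    regroup : ∀ j → j ℕ.≤ k → P (suc j) * h (suc k ∸ j) + r * (P (suc j) * H (k ∸ j)) ≈ P (suc j) * H (suc k ∸ j)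
    regroup j j≤k = begin
      P (suc j) * h (suc k ∸ j) + r * (P (suc j) * H (k ∸ j))
        ≈⟨ solve 4 (λ p a r b → p :* a :+ r :* (p :* b) := p :* (a :+ r :* b)) refl _ _ r _ ⟩
      P (suc j) * (h (suc k ∸ j) + r * H (k ∸ j))
        ≈⟨ *-congˡ (+-congʳ (completeHom-cong n 1+k∸j≡1+[k∸j])) ⟩
      P (suc j) * H (suc (k ∸ j))
        ≈⟨ *-congˡ (completeHom-cong (suc n) (≡.sym 1+k∸j≡1+[k∸j])) ⟩
      P (suc j) * H (suc k ∸ j)
        ∎
      where
      1+k∸j≡1+[k∸j] : suc k ∸ j ≡ suc (k ∸ j)
      1+k∸j≡1+[k∸j] = ℕₚ.+-∸-assoc 1 j≤k

    merge : sumR (suc (suc k)) (λ j → P (suc j) * h (suc k ∸ j)) + r * newtonSum k (suc n) ≈ newtonSum (suc k) (suc n)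
    merge = begin
      sumR (suc k) (λ j → P (suc j) * h (suc k ∸ j)) + P (suc (suc k)) * h (k ∸ k) + r * newtonSum k (suc n)
        ≈⟨ +-congˡ (*-distribˡ-sumR (suc k) r _) ⟩
      sumR (suc k) (λ j → P (suc j) * h (suc k ∸ j)) + P (suc (suc k)) * h (k ∸ k)
        + sumR (suc k) (λ j → r * (P (suc j) * H (k ∸ j)))
        ≈⟨ solve 3 (λ a b c → a :+ b :+ c := (a :+ c) :+ b) refl _ _ _ ⟩
      (sumR (suc k) (λ j → P (suc j) * h (suc k ∸ j)) + sumR (suc k) (λ j → r * (P (suc j) * H (k ∸ j))))
        + P (suc (suc k)) * h (k ∸ k)
        ≈⟨ +-cong (trans (sym (sumR-+ (suc k) _ _)) (sumR-cong-< (suc k) (λ j j<1+k → regroup j (ℕₚ.≤-pred j<1+k))))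
                  (*-congˡ (trans (completeHom-cong n (ℕₚ.n∸n≡0 k)) (completeHom-cong (suc n) (≡.sym (ℕₚ.n∸n≡0 k))))) ⟩
      newtonSum (suc k) (suc n)
        ∎

  fromℕ-C-factorials : ∀ {k j} → j ℕ.≤ k → fromℕ (k C j) * (fromℕ (j !) * fromℕ ((k ∸ j) !)) ≈ fromℕ (k !)
  fromℕ-C-factorials {k} {j} j≤k = trans (*-congˡ (sym (fromℕ-* (j !) _)))
    (trans (sym (fromℕ-* (k C j) _)) (fromℕ-cong (nCk*[k!*[n∸k]!]≡n! j≤k)))

  module _ (n : ℕ) where
    private
      xs : ℕ → Carrier
      xs i = fromℕ (i !) * harm n (suc i)

    -- About the whole list [Yₖ, …, Y₀], as the recurrence for Yₖ₊₁ uses all of it.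
    bellList-completeHom : ∀ k j → j ℕ.≤ k → lookupD (bellList xs k) j ≈ fromℕ ((k ∸ j) !) * completeHom (k ∸ j) n
    bellList-completeHom zero    zero    _ = solve 0 (𝟙 := (𝟙 :+ 𝟘) :* 𝟙) refl
    bellList-completeHom (suc k) (suc j) (ℕ.s≤s j≤k) = bellList-completeHom k j j≤k
    bellList-completeHom (suc k) zero    _ = begin
      sumR (suc k) (λ j → fromℕ (k C j) * xs j * lookupD (bellList xs k) j)
        ≈⟨ sumR-cong-< (suc k) (λ j j<1+k → cancel-factorials j (ℕₚ.≤-pred j<1+k)) ⟩
      sumR (suc k) (λ j → fromℕ (k !) * (harm n (suc j) * completeHom (k ∸ j) n))
        ≈⟨ *-distribˡ-sumR (suc k) _ _ ⟨
      fromℕ (k !) * newtonSum k n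
        ≈⟨ *-congˡ (newton-identity n k) ⟨
      fromℕ (k !) * (fromℕ (suc k) * completeHom (suc k) n)
        ≈⟨ solve 3 (λ a b x → a :* (b :* x) := (b :* a) :* x) refl _ _ _ ⟩
      fromℕ (suc k) * fromℕ (k !) * completeHom (suc k) n
        ≈⟨ *-congʳ (fromℕ-* (suc k) (k !)) ⟨
      fromℕ (suc k !) * completeHom (suc k) n
        ∎
      where
      cancel-factorials : ∀ j → j ℕ.≤ k → fromℕ (k C j) * xs j * lookupD (bellList xs k) j
                             ≈ fromℕ (k !) * (harm n (suc j) * completeHom (k ∸ j) n)
      cancel-factorials j j≤k = begin
        fromℕ (k C j) * (fromℕ (j !) * harm n (suc j)) * lookupD (bellList xs k) j
          ≈⟨ *-congˡ (bellList-completeHom k j j≤k) ⟩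
        fromℕ (k C j) * (fromℕ (j !) * harm n (suc j)) * (fromℕ ((k ∸ j) !) * completeHom (k ∸ j) n)
          ≈⟨ solve 5 (λ c f p g h → c :* (f :* p) :* (g :* h) := (c :* (f :* g)) :* (p :* h)) refl _ _ _ _ _ ⟩
        fromℕ (k C j) * (fromℕ (j !) * fromℕ ((k ∸ j) !)) * (harm n (suc j) * completeHom (k ∸ j) n)
          ≈⟨ *-congʳ (fromℕ-C-factorials j≤k) ⟩
        fromℕ (k !) * (harm n (suc j) * completeHom (k ∸ j) n)
          ∎

  bellNum/k!≈completeHom : ∀ k n → bellNum k n / fromℕ (k !) ≈ completeHom k n
  bellNum/k!≈completeHom k n = begin
    bellNum k n * inv (fromℕ (k !))                       ≈⟨ *-congʳ (bellList-completeHom n k 0 ℕ.z≤n) ⟩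
    fromℕ (k !) * completeHom k n * inv (fromℕ (k !))     ≈⟨ solve 3 (λ a h b → a :* h :* b := (a :* b) :* h) refl _ _ _ ⟩
    fromℕ (k !) * inv (fromℕ (k !)) * completeHom k n     ≈⟨ *-congʳ (inv-inverse _ (fromℕ≉0 (k !) {{ℕₚ._!≢0 k}})) ⟩
    1# * completeHom k n                                  ≈⟨ *-identityˡ _ ⟩
    completeHom k n                                       ∎

  -- Stirling numbers and the expansion of the alternating sums

  stirlingRatio : ℕ → ℕ → Carrier
  stirlingRatio j q = fromℕ (stirling1 j q) / fromℕ (j !)

  stirlingRatio-cong : ∀ j {q q′} → q ≡ q′ → stirlingRatio j q ≈ stirlingRatio j q′
  stirlingRatio-cong j q≡q′ = reflexive (≡.cong (stirlingRatio j) q≡q′)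

  inv-fromℕ-suc! : ∀ j → inv (fromℕ (suc j !)) ≈ invSuc j * inv (fromℕ (j !))
  inv-fromℕ-suc! j = sym (inv-unique (fromℕ≉0 (suc j !) {{ℕₚ._!≢0 (suc j)}}) (begin
    fromℕ (suc j !) * (invSuc j * inv (fromℕ (j !)))
      ≈⟨ *-congʳ (fromℕ-* (suc j) (j !)) ⟩
    fromℕ (suc j) * fromℕ (j !) * (invSuc j * inv (fromℕ (j !)))
      ≈⟨ solve 4 (λ a b c d → a :* b :* (c :* d) := (a :* c) :* (b :* d)) refl _ _ _ _ ⟩
    (fromℕ (suc j) * invSuc j) * (fromℕ (j !) * inv (fromℕ (j !)))
      ≈⟨ *-cong (fromℕ-suc*invSuc j) (inv-inverse _ (fromℕ≉0 (j !) {{ℕₚ._!≢0 j}})) ⟩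
    1# * 1#
      ≈⟨ *-identityˡ _ ⟩
    1#
      ∎))

  stirlingRatio-suc : ∀ j q → fromℕ (suc j) * stirlingRatio (suc j) (suc q)
                              ≈ stirlingRatio j q + fromℕ j * stirlingRatio j (suc q)
  stirlingRatio-suc j q = begin
    fromℕ (suc j) * (fromℕ (stirling1 j q ℕ.+ j ℕ.* stirling1 j (suc q)) * inv (fromℕ (suc j !)))
      ≈⟨ *-congˡ (*-cong (trans (fromℕ-+ (stirling1 j q) _) (+-congˡ (fromℕ-* j _))) (inv-fromℕ-suc! j)) ⟩
    fromℕ (suc j) * ((fromℕ (stirling1 j q) + fromℕ j * fromℕ (stirling1 j (suc q))) * (invSuc j * inv (fromℕ (j !))))
      ≈⟨ solve 6 (λ J a k b r i → J :* ((a :+ k :* b) :* (r :* i)) := (J :* r) :* (a :* i :+ k :* (b :* i))) refl _ _ _ _ _ _ ⟩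
    (fromℕ (suc j) * invSuc j) * (stirlingRatio j q + fromℕ j * stirlingRatio j (suc q))
      ≈⟨ trans (*-congʳ (fromℕ-suc*invSuc j)) (*-identityˡ _) ⟩
    stirlingRatio j q + fromℕ j * stirlingRatio j (suc q)
      ∎

  stirlingRatio-one : ∀ j → stirlingRatio (suc j) 1 ≈ invSuc j
  stirlingRatio-one zero    = solve 1 (λ r → (𝟙 :+ 𝟘) :* r := r) refl _
  stirlingRatio-one (suc j) = inv-unique (fromℕ≉0 (suc (suc j))) (begin
    fromℕ (suc (suc j)) * stirlingRatio (suc (suc j)) 1   ≈⟨ stirlingRatio-suc (suc j) 0 ⟩
    0# * _ + fromℕ (suc j) * stirlingRatio (suc j) 1      ≈⟨ +-cong (zeroˡ _) (*-congˡ (stirlingRatio-one j)) ⟩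
    0# + fromℕ (suc j) * invSuc j                         ≈⟨ trans (+-identityˡ _) (fromℕ-suc*invSuc j) ⟩
    1#                                                    ∎)

  -- The braced factor of the theorem, with Yᵢ(n)/i! replaced by hᵢ(1, 1/2, …, 1/n).
  stirlingHom : ℕ → ℕ → ℕ → Carrier
  stirlingHom p j n = sumR p (λ i → pow (- 1#) i * completeHom i n * stirlingRatio j (p ∸ i))

  stirlingHom-one : ∀ j n → stirlingHom 1 (suc j) n ≈ invSuc j
  stirlingHom-one j n = trans (solve 1 (λ s → 𝟘 :+ 𝟙 :* 𝟙 :* s := s) refl _) (stirlingRatio-one j)

  stirlingHom-suc-n : ∀ p j n → stirlingHom (suc p) j (suc n) + invSuc n * stirlingHom p j (suc n) ≈ stirlingHom (suc p) j n
  stirlingHom-suc-n p j n = begin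
    stirlingHom (suc p) j (suc n) + invSuc n * stirlingHom p j (suc n)
      ≈⟨ +-cong (sumR-head p _) (*-distribˡ-sumR p (invSuc n) _) ⟩
    (1# * 1# * stirlingRatio j (suc p) + sumR p (λ i → pow (- 1#) (suc i) * completeHom (suc i) (suc n) * stirlingRatio j (p ∸ i)))
      + sumR p (λ i → invSuc n * (pow (- 1#) i * completeHom i (suc n) * stirlingRatio j (p ∸ i)))
      ≈⟨ trans (+-assoc _ _ _) (+-congˡ (trans (sym (sumR-+ p _ _)) (sumR-cong p λ i →
           solve 5 (λ s h r H q → (:- 𝟙 :* s) :* (h :+ r :* H) :* q :+ r :* (s :* H :* q) := (:- 𝟙 :* s) :* h :* q) refl
             (pow (- 1#) i) (completeHom (suc i) n) (invSuc n) (completeHom i (suc n)) (stirlingRatio j (p ∸ i))))) ⟩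
    1# * 1# * stirlingRatio j (suc p) + sumR p (λ i → pow (- 1#) (suc i) * completeHom (suc i) n * stirlingRatio j (p ∸ i))
      ≈⟨ sumR-head p _ ⟨
    stirlingHom (suc p) j n
      ∎

  stirlingHom-suc-j : ∀ p j n → fromℕ (suc (suc j)) * stirlingHom (suc p) (suc (suc j)) n
                                ≈ stirlingHom p (suc j) n + fromℕ (suc j) * stirlingHom (suc p) (suc j) n
  stirlingHom-suc-j p j n = begin
    fromℕ (suc (suc j)) * stirlingHom (suc p) (suc (suc j)) n
      ≈⟨ *-distribˡ-sumR (suc p) _ _ ⟩
    sumR (suc p) (λ i → fromℕ (suc (suc j)) * (u i * stirlingRatio (suc (suc j)) (suc p ∸ i)))
      ≈⟨ sumR-cong-< (suc p) (λ i i<1+p → recurrence i (ℕₚ.≤-pred i<1+p)) ⟩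
    sumR (suc p) (λ i → u i * stirlingRatio (suc j) (p ∸ i) + fromℕ (suc j) * (u i * stirlingRatio (suc j) (suc p ∸ i)))
      ≈⟨ sumR-+ (suc p) _ _ ⟩
    (stirlingHom p (suc j) n + u p * stirlingRatio (suc j) (p ∸ p))
      + sumR (suc p) (λ i → fromℕ (suc j) * (u i * stirlingRatio (suc j) (suc p ∸ i)))
      ≈⟨ +-cong (trans (+-congˡ (trans (*-congˡ (trans (stirlingRatio-cong (suc j) (ℕₚ.n∸n≡0 p)) (zeroˡ _))) (zeroʳ _)))
                       (+-identityʳ _))
                (sym (*-distribˡ-sumR (suc p) _ _)) ⟩
    stirlingHom p (suc j) n + fromℕ (suc j) * stirlingHom (suc p) (suc j) n
      ∎
    where
    u : ℕ → Carrier
    u i = pow (- 1#) i * completeHom i n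

    recurrence : ∀ i → i ℕ.≤ p → fromℕ (suc (suc j)) * (u i * stirlingRatio (suc (suc j)) (suc p ∸ i))
                           ≈ u i * stirlingRatio (suc j) (p ∸ i) + fromℕ (suc j) * (u i * stirlingRatio (suc j) (suc p ∸ i))
    recurrence i i≤p = begin
      fromℕ (suc (suc j)) * (u i * stirlingRatio (suc (suc j)) (suc p ∸ i))
        ≈⟨ *-congˡ (*-congˡ (stirlingRatio-cong (suc (suc j)) 1+p∸i≡1+[p∸i])) ⟩
      fromℕ (suc (suc j)) * (u i * stirlingRatio (suc (suc j)) (suc (p ∸ i)))
        ≈⟨ solve 3 (λ J x y → J :* (x :* y) := x :* (J :* y)) refl _ (u i) _ ⟩
      u i * (fromℕ (suc (suc j)) * stirlingRatio (suc (suc j)) (suc (p ∸ i)))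
        ≈⟨ *-congˡ (stirlingRatio-suc (suc j) (p ∸ i)) ⟩
      u i * (stirlingRatio (suc j) (p ∸ i) + fromℕ (suc j) * stirlingRatio (suc j) (suc (p ∸ i)))
        ≈⟨ solve 4 (λ x a K b → x :* (a :+ K :* b) := x :* a :+ K :* (x :* b)) refl (u i) _ _ _ ⟩
      u i * stirlingRatio (suc j) (p ∸ i) + fromℕ (suc j) * (u i * stirlingRatio (suc j) (suc (p ∸ i)))
        ≈⟨ +-congˡ (*-congˡ (*-congˡ (stirlingRatio-cong (suc j) (≡.sym 1+p∸i≡1+[p∸i])))) ⟩
      u i * stirlingRatio (suc j) (p ∸ i) + fromℕ (suc j) * (u i * stirlingRatio (suc j) (suc p ∸ i))
        ∎
      where
      1+p∸i≡1+[p∸i] : suc p ∸ i ≡ suc (p ∸ i)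
      1+p∸i≡1+[p∸i] = ℕₚ.+-∸-assoc 1 i≤p

  stirlingHom-diagonal : ∀ j p → stirlingHom (suc p) (suc j) (suc j) ≈ pow (- 1#) p * pow (invSuc j) (suc p)
  stirlingHom-subdiagonal : ∀ j p → stirlingHom (suc (suc p)) (suc j) j ≈ 0#

  stirlingHom-diagonal j zero    = trans (stirlingHom-one j (suc j)) (solve 1 (λ r → r := 𝟙 :* (r :* 𝟙)) refl _)
  stirlingHom-diagonal j (suc p) = begin
    D (suc p)                                     ≈⟨ solve 2 (λ a b → a := (a :+ b) :- b) refl _ (invSuc j * D p) ⟩
    (D (suc p) + invSuc j * D p) - invSuc j * D p ≈⟨ +-cong (trans (stirlingHom-suc-n (suc p) (suc j) j) (stirlingHom-subdiagonal j p))
                                                            (-‿cong (*-congˡ (stirlingHom-diagonal j p))) ⟩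
    0# - invSuc j * (pow (- 1#) p * pow (invSuc j) (suc p))
      ≈⟨ solve 3 (λ r s q → 𝟘 :- r :* (s :* q) := (:- 𝟙 :* s) :* (r :* q)) refl (invSuc j) _ _ ⟩
    pow (- 1#) (suc p) * pow (invSuc j) (suc (suc p))
      ∎
    where
    D : ℕ → Carrier
    D p = stirlingHom (suc p) (suc j) (suc j)

  stirlingHom-subdiagonal zero    p = sumR-≈0 (suc (suc p)) vanish
    where
    vanish : ∀ i → i ℕ.< suc (suc p) → pow (- 1#) i * completeHom i 0 * stirlingRatio 1 (suc (suc p) ∸ i) ≈ 0#
    vanish zero    _ = trans (*-congˡ (zeroˡ _)) (zeroʳ _)
    vanish (suc i) _ = trans (*-congʳ (zeroʳ _)) (zeroˡ _)
  stirlingHom-subdiagonal (suc j) p = *-cancelˡ (fromℕ≉0 (suc (suc j))) (begin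
    fromℕ (suc (suc j)) * stirlingHom (suc (suc p)) (suc (suc j)) (suc j)
      ≈⟨ stirlingHom-suc-j (suc p) j (suc j) ⟩
    stirlingHom (suc p) (suc j) (suc j) + fromℕ (suc j) * stirlingHom (suc (suc p)) (suc j) (suc j)
      ≈⟨ +-cong (stirlingHom-diagonal j p) (*-congˡ (stirlingHom-diagonal j (suc p))) ⟩
    pow (- 1#) p * pow r (suc p) + fromℕ (suc j) * (pow (- 1#) (suc p) * pow r (suc (suc p)))
      ≈⟨ solve 4 (λ s q K r → s :* q :+ K :* ((:- 𝟙 :* s) :* (r :* q)) := s :* q :* (𝟙 :- K :* r)) refl _ _ _ r ⟩
    pow (- 1#) p * pow r (suc p) * (1# - fromℕ (suc j) * r)
      ≈⟨ *-congˡ (trans (+-congˡ (-‿cong (fromℕ-suc*invSuc j))) (-‿inverseʳ 1#)) ⟩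
    pow (- 1#) p * pow r (suc p) * 0#
      ≈⟨ trans (zeroʳ _) (sym (zeroʳ _)) ⟩
    fromℕ (suc (suc j)) * 0#
      ∎)
    where
    r : Carrier
    r = invSuc j

  expansionCoeff : ℕ → ℕ → ℕ → Carrier
  expansionCoeff p j n = pow (- 1#) p * stirlingHom (suc p) (suc j) n

  expansionCoeff-zero : ∀ j n → expansionCoeff 0 j n ≈ invSuc j
  expansionCoeff-zero j n = trans (*-identityˡ _) (stirlingHom-one j n)

  expansionCoeff-suc : ∀ p j n → expansionCoeff (suc p) j (suc n)
                               ≈ expansionCoeff (suc p) j n + invSuc n * expansionCoeff p j (suc n)
  expansionCoeff-suc p j n = begin
    s′ * X
      ≈⟨ *-congˡ (solve 3 (λ a c r → a := (a :+ r :* c) :- r :* c) refl X Z (invSuc n)) ⟩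
    s′ * ((X + invSuc n * Z) - invSuc n * Z)
      ≈⟨ *-congˡ (+-congʳ (stirlingHom-suc-n (suc p) (suc j) n)) ⟩
    s′ * (Y - invSuc n * Z)
      ≈⟨ solve 4 (λ s b r c → (:- 𝟙 :* s) :* (b :- r :* c) := (:- 𝟙 :* s) :* b :+ r :* (s :* c)) refl
                 (pow (- 1#) p) Y (invSuc n) Z ⟩
    expansionCoeff (suc p) j n + invSuc n * expansionCoeff p j (suc n)
      ∎
    where
    s′ X Y Z : Carrier
    s′ = pow (- 1#) (suc p)
    X = stirlingHom (suc (suc p)) (suc j) (suc n)
    Y = stirlingHom (suc (suc p)) (suc j) n
    Z = stirlingHom (suc p) (suc j) (suc n)

  expansionCoeff-diagonal : ∀ p n → expansionCoeff p n (suc n) ≈ pow (invSuc n) (suc p)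
  expansionCoeff-diagonal p n = begin
    pow (- 1#) p * stirlingHom (suc p) (suc n) (suc n)               ≈⟨ *-congˡ (stirlingHom-diagonal n p) ⟩
    pow (- 1#) p * (pow (- 1#) p * pow (invSuc n) (suc p))          ≈⟨ *-assoc _ _ _ ⟨
    (pow (- 1#) p * pow (- 1#) p) * pow (invSuc n) (suc p)          ≈⟨ trans (*-congʳ (sign-square p)) (*-identityˡ _) ⟩
    pow (invSuc n) (suc p)                                          ∎

  altBinomial-expansion : ∀ p n t → altBinomial (suc p) n t ≈ sumR n (λ j → (1# - pow (1# - t) (suc j)) * expansionCoeff p j n)
  altBinomial-expansion p       zero    t = refl
  altBinomial-expansion zero    (suc n) t = begin
    altBinomial 1 (suc n) t
      ≈⟨ altBinomial-suc 0 n t ⟩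
    altBinomial 1 n t + invSuc n * altBinomial 0 (suc n) t
      ≈⟨ +-cong (altBinomial-expansion 0 n t) (*-congˡ (altBinomial-zero (suc n) t)) ⟩
    sumR n (λ j → T j * expansionCoeff 0 j n) + invSuc n * T n
      ≈⟨ +-cong (sumR-cong n (λ j → *-congˡ (trans (expansionCoeff-zero j n) (sym (expansionCoeff-zero j (suc n))))))
                (trans (*-comm _ _) (*-congˡ (sym (expansionCoeff-zero n (suc n))))) ⟩
    sumR (suc n) (λ j → T j * expansionCoeff 0 j (suc n))
      ∎
    where
    T : ℕ → Carrier
    T j = 1# - pow (1# - t) (suc j)
  altBinomial-expansion (suc p) (suc n) t = begin
    altBinomial (suc (suc p)) (suc n) t
      ≈⟨ altBinomial-suc (suc p) n t ⟩
    altBinomial (suc (suc p)) n t + r * altBinomial (suc p) (suc n) t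
      ≈⟨ +-cong (altBinomial-expansion (suc p) n t) (*-congˡ (altBinomial-expansion p (suc n) t)) ⟩
    sumR n (λ j → T j * g (suc p) j n) + r * (sumR n (λ j → T j * g p j (suc n)) + T n * g p n (suc n))
      ≈⟨ +-congˡ (trans (distribˡ _ _ _) (+-congʳ (*-distribˡ-sumR n r _))) ⟩
    sumR n (λ j → T j * g (suc p) j n) + (sumR n (λ j → r * (T j * g p j (suc n))) + r * (T n * g p n (suc n)))
      ≈⟨ +-assoc _ _ _ ⟨
    (sumR n (λ j → T j * g (suc p) j n) + sumR n (λ j → r * (T j * g p j (suc n)))) + r * (T n * g p n (suc n))
      ≈⟨ +-cong (trans (sym (sumR-+ n _ _)) (sumR-cong n λ j → trans
                  (solve 4 (λ u a r b → u :* a :+ r :* (u :* b) := u :* (a :+ r :* b)) refl (T j) _ r _)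
                  (*-congˡ (sym (expansionCoeff-suc p j n)))))
                (trans (solve 3 (λ r u b → r :* (u :* b) := u :* (r :* b)) refl r (T n) _) (*-congˡ diagonal)) ⟩
    sumR (suc n) (λ j → T j * g (suc p) j (suc n))
      ∎
    where
    r : Carrier
    r = invSuc n
    g : ℕ → ℕ → ℕ → Carrier
    g = expansionCoeff
    T : ℕ → Carrier
    T j = 1# - pow (1# - t) (suc j)
    diagonal : r * g p n (suc n) ≈ g (suc p) n (suc n)
    diagonal = trans (*-congˡ (expansionCoeff-diagonal p n)) (sym (expansionCoeff-diagonal (suc p) n))

  -- The identity for a + b = 1, and homogenisation

  binomialTransform-zetaStar : ∀ {a b} → a + b ≈ 1# → ∀ p n z →
    binomialTransform a b n (λ k → zetaStar k (ones (suc p)) z)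
    ≈ pow (- 1#) p * sumR n (λ j → (pow (1# - a * (1# - z)) (suc j) - pow (1# - a) (suc j)) * stirlingHom (suc p) (suc j) n)
  binomialTransform-zetaStar {a} {b} a+b≈1 p n z = begin
    binomialTransform a b n (λ k → zetaStar k (ones (suc p)) z)
      ≈⟨ binomialTransform-cong a b n (λ k → zetaStar-ones p k z) ⟩
    binomialTransform a b n (λ k → altBinomial (suc p) k 1# - altBinomial (suc p) k (1# - z))
      ≈⟨ binomialTransform-sub a b n _ _ ⟩
    binomialTransform a b n (λ k → altBinomial (suc p) k 1#) - binomialTransform a b n (λ k → altBinomial (suc p) k (1# - z))
      ≈⟨ +-cong (altBinomial-transform a+b≈1 (suc p) n 1#) (-‿cong (altBinomial-transform a+b≈1 (suc p) n (1# - z))) ⟩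
    altBinomial (suc p) n (a * 1#) - altBinomial (suc p) n (a * (1# - z))
      ≈⟨ +-cong (altBinomial-expansion p n (a * 1#)) (-‿cong (altBinomial-expansion p n (a * (1# - z)))) ⟩
    sumR n (λ j → (1# - u j) * g j) - sumR n (λ j → (1# - v j) * g j)
      ≈⟨ sumR-sub n _ _ ⟨
    sumR n (λ j → (1# - u j) * g j - (1# - v j) * g j)
      ≈⟨ sumR-cong n (λ j → solve 4 (λ u v s h → (𝟙 :- u) :* (s :* h) :- (𝟙 :- v) :* (s :* h) := s :* ((v :- u) :* h))
                                      refl (u j) (v j) (pow (- 1#) p) (stirlingHom (suc p) (suc j) n)) ⟩
    sumR n (λ j → pow (- 1#) p * ((v j - u j) * stirlingHom (suc p) (suc j) n))
      ≈⟨ *-distribˡ-sumR n _ _ ⟨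
    pow (- 1#) p * sumR n (λ j → (v j - u j) * stirlingHom (suc p) (suc j) n)
      ≈⟨ *-congˡ (sumR-cong n λ j → *-congʳ (+-congˡ (-‿cong (pow-cong (suc j) (+-congˡ (-‿cong (*-identityʳ a))))))) ⟩
    pow (- 1#) p * sumR n (λ j → (v j - pow (1# - a) (suc j)) * stirlingHom (suc p) (suc j) n)
      ∎
    where
    g u v : ℕ → Carrier
    g j = expansionCoeff p j n
    u j = pow (1# - a * 1#) (suc j)
    v j = pow (1# - a * (1# - z)) (suc j)

  binomialSum-homogenise : ∀ {x y} → ¬ (x + y ≈ 0#) → ∀ n (g : ℕ → Carrier) →
    sumR (suc n) (λ k → pow x k * pow y (n ∸ k) * fromℕ (n C k) * g k)
    ≈ pow (x + y) n * binomialTransform (x / (x + y)) (y / (x + y)) n g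
  binomialSum-homogenise {x} {y} x+y≉0 n g = begin
    sumR (suc n) (λ k → pow x k * pow y (n ∸ k) * fromℕ (n C k) * g k)
      ≈⟨ sumR-cong-< (suc n) (λ k k<1+n → *-congʳ (*-congʳ (factor k (ℕₚ.≤-pred k<1+n)))) ⟩
    sumR (suc n) (λ k → pow s n * (pow a k * pow b (n ∸ k)) * fromℕ (n C k) * g k)
      ≈⟨ sumR-cong (suc n) (λ k → solve 5 (λ S u v c h → S :* (u :* v) :* c :* h := S :* (c :* (u :* v :* h))) refl _ _ _ _ _) ⟩
    sumR (suc n) (λ k → pow s n * (fromℕ (n C k) * (pow a k * pow b (n ∸ k) * g k)))
      ≈⟨ *-distribˡ-sumR (suc n) _ _ ⟨
    pow s n * binomialTransform a b n g
      ∎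
    where
    s a b : Carrier
    s = x + y
    a = x / s
    b = y / s

    rescale : ∀ u → u ≈ s * (u / s)
    rescale u = sym (trans (solve 3 (λ s u i → s :* (u :* i) := u :* (s :* i)) refl s u (inv s))
                           (trans (*-congˡ (inv-inverse s x+y≉0)) (*-identityʳ u)))

    factor : ∀ k → k ℕ.≤ n → pow x k * pow y (n ∸ k) ≈ pow s n * (pow a k * pow b (n ∸ k))
    factor k k≤n = begin
      pow x k * pow y (n ∸ k)
        ≈⟨ *-cong (trans (pow-cong k (rescale x)) (pow-* s a k)) (trans (pow-cong (n ∸ k) (rescale y)) (pow-* s b (n ∸ k))) ⟩
      pow s k * pow a k * (pow s (n ∸ k) * pow b (n ∸ k))
        ≈⟨ solve 4 (λ p q r t → p :* q :* (r :* t) := (p :* r) :* (q :* t)) refl _ _ _ _ ⟩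
      pow s k * pow s (n ∸ k) * (pow a k * pow b (n ∸ k))
        ≈⟨ *-congʳ (trans (sym (pow-+ s k (n ∸ k))) (reflexive (≡.cong (pow s) (ℕₚ.m+[n∸m]≡n k≤n)))) ⟩
      pow s n * (pow a k * pow b (n ∸ k))
        ∎

  x/[x+y]+y/[x+y]≈1 : ∀ {x y} → ¬ (x + y ≈ 0#) → x / (x + y) + y / (x + y) ≈ 1#
  x/[x+y]+y/[x+y]≈1 x+y≉0 = trans (sym (distribʳ _ _ _)) (inv-inverse _ x+y≉0)

  1-x/[x+y]≈y/[x+y] : ∀ {x y} → ¬ (x + y ≈ 0#) → 1# - x / (x + y) ≈ y / (x + y)
  1-x/[x+y]≈y/[x+y] x+y≉0 =
    trans (+-congʳ (sym (x/[x+y]+y/[x+y]≈1 x+y≉0))) (solve 2 (λ a b → (a :+ b) :- a := b) refl _ _)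

  1-x/[x+y]*[1-z]≈[xz+y]/[x+y] : ∀ {x y} z → ¬ (x + y ≈ 0#) → 1# - x / (x + y) * (1# - z) ≈ (x * z + y) / (x + y)
  1-x/[x+y]*[1-z]≈[xz+y]/[x+y] {x} {y} z x+y≉0 = begin
    1# - x / (x + y) * (1# - z)                  ≈⟨ +-congʳ (x/[x+y]+y/[x+y]≈1 x+y≉0) ⟨
    (x / (x + y) + y / (x + y)) - x / (x + y) * (1# - z)
      ≈⟨ solve 4 (λ x y z i → (x :* i :+ y :* i) :- x :* i :* (𝟙 :- z) := (x :* z :+ y) :* i) refl x y z _ ⟩
    (x * z + y) / (x + y)                        ∎

  bellStirlingSum≈stirlingHom : ∀ p j n →
    sumR p (λ i → pow (- 1#) i * (bellNum i n / fromℕ (i !)) * (fromℕ (stirling1 j (p ∸ i)) / fromℕ (j !)))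
    ≈ stirlingHom p j n
  bellStirlingSum≈stirlingHom p j n = sumR-cong p (λ i → *-congʳ (*-congˡ (bellNum/k!≈completeHom i n)))

theorem1p1 : ∀ {c ℓ₁ ℓ₂} (F : OrderedField c ℓ₁ ℓ₂) →
  let open OrderedField F
      open OFDefs F
  in (x y z : Carrier) (n p : ℕ) →
     ¬ ((x + y) ≈ 0#) → 0# ≤ (x / (x + y)) → z ≤ 1# →
     1 Data.Nat.≤ n → 1 Data.Nat.≤ p →
     sumR (suc n) (λ k → pow x k * pow y (n ∸ k) * fromℕ (n C k) * zetaStar k (ones p) z)
     ≈ pow (- 1#) (p ∸ 1) * pow (x + y) n *
       sumR n (λ j′ →
         (pow ((x * z + y) / (x + y)) (suc j′) - pow (y / (x + y)) (suc j′)) *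
         sumR p (λ i →
           pow (- 1#) i * (bellNum i n / fromℕ (i !)) *
           (fromℕ (stirling1 (suc j′) (p ∸ i)) / fromℕ (suc j′ !))))
theorem1p1 F x y z n (suc q) x+y≉0 _ _ _ _ = begin
  sumR (suc n) (λ k → pow x k * pow y (n ∸ k) * fromℕ (n C k) * zetaStar k (ones (suc q)) z)
    ≈⟨ binomialSum-homogenise F x+y≉0 n _ ⟩
  pow s n * binomialTransform F (x / s) (y / s) n (λ k → zetaStar k (ones (suc q)) z)
    ≈⟨ *-congˡ (binomialTransform-zetaStar F (x/[x+y]+y/[x+y]≈1 F x+y≉0) q n z) ⟩
  pow s n * (pow (- 1#) q * sumR n (λ j → (pow (1# - x / s * (1# - z)) (suc j) - pow (1# - x / s) (suc j)) * coeff j))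
    ≈⟨ trans (sym (*-assoc _ _ _)) (*-congʳ (*-comm _ _)) ⟩
  pow (- 1#) q * pow s n * sumR n (λ j → (pow (1# - x / s * (1# - z)) (suc j) - pow (1# - x / s) (suc j)) * coeff j)
    ≈⟨ *-congˡ (sumR-cong F n λ j →
         *-cong (+-cong (pow-cong F (suc j) (1-x/[x+y]*[1-z]≈[xz+y]/[x+y] F z x+y≉0))
                        (-‿cong (pow-cong F (suc j) (1-x/[x+y]≈y/[x+y] F x+y≉0))))
                (sym (bellStirlingSum≈stirlingHom F (suc q) (suc j) n))) ⟩
  pow (- 1#) q * pow s n *
    sumR n (λ j → (pow ((x * z + y) / s) (suc j) - pow (y / s) (suc j)) *
      sumR (suc q) (λ i → pow (- 1#) i * (bellNum i n / fromℕ (i !)) *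
                          (fromℕ (stirling1 (suc j) (suc q ∸ i)) / fromℕ (suc j !))))
    ∎
  where
  open OrderedField F
  open OFDefs F
  open import Relation.Binary.Reasoning.Setoid setoid
  s : Carrier
  s = x + y
  coeff : ℕ → Carrier
  coeff j = stirlingHom F (suc q) (suc j) n
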